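{- Let $\tilde r(a_t)$ be the estimated rank computed by the Dense Ranking algorithm described below at time $t$. Then $\mathbb{E}\left[\sum_{t=1}^{n}|\mathrm{rk}(a_t)-\tilde r(a_t)|\right]=O(n\sqrt{n})$.
   Context: Setting: $n$ elements with distinct values from a totally ordered set arrive online in uniformly random order; $a_t$ is the element arriving at time $t$ and $\mathrm{rk}(a)\in[n]$ its true rank. There are $n$ positions $[n]$; at time $t$ only comparisons among $a_1,\dots,a_t$ are known, and $a_t$ must be irrevocably placed in a free position $\pi(a_t)$. Dense Ranking algorithm: maintain a set $R$ of free positions, initially $R=[n]$. At time $t$: let $r_t=|\{t'<t: a_{t'}<a_t\}|$; sample $x_t$ uniformly from the real interval $[r_t\frac{n}{t},(r_t+1)\frac{n}{t}]$ and set $\tilde r(a_t)=\lceil x_t\rceil$; set $\pi(a_t)=\arg\min_{i\in R}|i-\tilde r(a_t)|$ and remove it from $R$. Expectation is over the random arrival order and the algorithm's randomness. -}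

module Defs where

open import Data.Nat as ℕ using (ℕ; zero; suc; _∸_; _!; ∣_-_∣)
open import Data.Nat.Properties using (_!≢0)
open import Data.Integer using (+_)
open import Data.Rational using (ℚ; _/_; _+_; _-_; _*_; _⊔_; _⊓_; 0ℚ)
open import Data.List using (List; []; _∷_; concatMap; map; foldr; filter; length; upTo)
open import Relation.Nullary.Decidable using (yes; no)

sumℚ : List ℚ → ℚ
sumℚ = foldr _+_ 0ℚ

-- Without loss of generality the n elements are identified with their true
-- ranks 1..n (values are distinct, only comparisons matter).  An arrival
-- order is a list [a_1, ..., a_n] which is a permutation of 1..n.

insertions : ℕ → List ℕ → List (List ℕ)
insertions x []       = (x ∷ []) ∷ []
insertions x (y ∷ ys) = (x ∷ y ∷ ys) ∷ map (y ∷_) (insertions x ys)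

perms : ℕ → List (List ℕ)
perms zero    = [] ∷ []
perms (suc n) = concatMap (insertions (suc n)) (perms n)

localRank : List ℕ → ℕ → ℕ
localRank earlier a = length (filter (ℕ._<? a) earlier)

-- For x uniform on [lo, hi] with lo = r n / t, hi = (r+1) n / t (t ≥ 1, n ≥ 1),
-- Pr[⌈x⌉ = k] = |[lo,hi] ∩ [k-1,k]| / (hi - lo), with hi - lo = n / t.
ceilProb : (n t : ℕ) → .{{_ : ℕ.NonZero n}} → .{{_ : ℕ.NonZero t}} →
           (r k : ℕ) → ℚ
ceilProb n t r k =
  (0ℚ ⊔ ((hi ⊓ (+ k / 1)) - (lo ⊔ (+ (k ∸ 1) / 1)))) * (+ t / n)
  where
    lo = + (r ℕ.* n) / t
    hi = + (suc r ℕ.* n) / t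

-- E[ |rk(a_t) - r̃(a_t)| ] for an arrival with true rank a at time t whose
-- local rank is r; r̃ = ⌈x_t⌉ ranges over 1..n (other values have probability 0).
expectedError : (n t : ℕ) → .{{_ : ℕ.NonZero n}} → .{{_ : ℕ.NonZero t}} →
                (r a : ℕ) → ℚ
expectedError n t r a =
  sumℚ (map (λ j → ceilProb n t r (suc j) * (+ ∣ a - suc j ∣ / 1)) (upTo n))

-- For a fixed arrival order, E_x[ Σ_t |rk(a_t) - r̃(a_t)| ]
-- (the x_t are independent; sum of the per-step expectations).
-- 'earlier' = a_1..a_{t-1} (in any order), the time of the next arrival is suc i.
orderError : (n : ℕ) → .{{_ : ℕ.NonZero n}} → List ℕ → ℕ → List ℕ → ℚ
orderError n earlier i []       = 0ℚ
orderError n earlier i (a ∷ as) =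
  expectedError n (suc i) (localRank earlier a) a
  + orderError n (a ∷ earlier) (suc i) as

-- E[ Σ_{t=1}^n |rk(a_t) - r̃(a_t)| ] over a uniformly random arrival order
-- (uniform over the n! permutations) and the algorithm's randomness.
expectedTotalError : (n : ℕ) → .{{_ : ℕ.NonZero n}} → ℚ
expectedTotalError n =
  sumℚ (map (orderError n [] 0) (perms n)) * (+ 1 / (n !)) {{n !≢0}}

-- At time t = k + 1 the arrival with true rank a and local rank r has its estimate ⌈x_t⌉ within
-- (D + n + t)/t of a, where D = |t·a − r·n|. Summed over all n! arrival orders, the statistics of (r, a)
-- at a fixed time obey a recurrence under insertion of the largest element, which yields exact second
-- moments and E[D²] ≤ 7n²t/6. AM-GM at the scale n·⌊√t⌋ then bounds the expected error at time t by
-- 4n/⌊√t⌋, and Σ_{t ≤ n} 1/⌊√t⌋ ≤ 5⌊√n⌋, so the expected total error is at most 20·n·⌊√n⌋ and its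
-- square at most 400·n³.

module Submission where

open import Defs
open import Data.Rational.Solver using (module +-*-Solver)

-- Fractions of natural numbers
module _ where
  open import Data.Nat as ℕ using (ℕ; suc; NonZero)
  import Data.Nat.Properties as ℕ
  open import Data.Nat.Tactic.RingSolver using (solve-∀)
  open import Data.Integer as ℤ using (+_)
  import Data.Integer.Properties as ℤ
  open import Data.Rational using (ℚ; _/_; _+_; _*_; _-_; 0ℚ; 1ℚ; _≤_; _<_; toℚᵘ; nonNegative)
  import Data.Rational.Properties as ℚ
  open import Data.Rational.Unnormalised as ℚᵘ using (mkℚᵘ; *≤*; *<*)
  import Data.Rational.Unnormalised.Properties as ℚᵘ
  open import Relation.Binary.PropositionalEquality
  open +-*-Solver using (_:+_; _:-_; _:=_)

  fromℕ : ℕ → ℚ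
  fromℕ k = + k / 1

  1/ℕ : (b : ℕ) → .{{NonZero b}} → ℚ
  1/ℕ b = + 1 / b

  private
    toℚᵘ-/ : ∀ a b .{{_ : NonZero b}} → toℚᵘ (+ a / b) ℚᵘ.≃ mkℚᵘ (+ a) (ℕ.pred b)
    toℚᵘ-/ a (suc b) = ℚ.toℚᵘ-fromℚᵘ (mkℚᵘ (+ a) b)

  /-mono-≤ : ∀ a b c d .{{_ : NonZero b}} .{{_ : NonZero d}} →
             a ℕ.* d ℕ.≤ c ℕ.* b → + a / b ≤ + c / d
  /-mono-≤ a b@(suc _) c d@(suc _) ad≤cb =
    ℚ.toℚᵘ-cancel-≤ (ℚᵘ.≤-respˡ-≃ (ℚᵘ.≃-sym (toℚᵘ-/ a b)) (ℚᵘ.≤-respʳ-≃ (ℚᵘ.≃-sym (toℚᵘ-/ c d))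
      (*≤* (subst₂ ℤ._≤_ (ℤ.pos-* a d) (ℤ.pos-* c b) (ℤ.+≤+ ad≤cb)))))

  /-cancel-< : ∀ a b c d .{{_ : NonZero b}} .{{_ : NonZero d}} →
               + a / b < + c / d → a ℕ.* d ℕ.< c ℕ.* b
  /-cancel-< a b@(suc _) c d@(suc _) p<q
    with ℚᵘ.<-respˡ-≃ (toℚᵘ-/ a b) (ℚᵘ.<-respʳ-≃ (toℚᵘ-/ c d) (ℚ.toℚᵘ-mono-< p<q))
  ... | *<* ad<cb = ℤ.drop‿+<+ (subst₂ ℤ._<_ (sym (ℤ.pos-* a d)) (sym (ℤ.pos-* c b)) ad<cb)

  /-cong : ∀ a b c d .{{_ : NonZero b}} .{{_ : NonZero d}} →
           a ℕ.* d ≡ c ℕ.* b → + a / b ≡ + c / d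
  /-cong a b c d ad≡cb =
    ℚ.≤-antisym (/-mono-≤ a b c d (ℕ.≤-reflexive ad≡cb)) (/-mono-≤ c d a b (ℕ.≤-reflexive (sym ad≡cb)))

  /-* : ∀ a b c d .{{_ : NonZero b}} .{{_ : NonZero d}} →
        (+ a / b) * (+ c / d) ≡ (+ (a ℕ.* c) / (b ℕ.* d)) {{ℕ.m*n≢0 b d}}
  /-* a b@(suc _) c d@(suc _) = ℚ.toℚᵘ-injective (begin-equality
    toℚᵘ ((+ a / b) * (+ c / d))            ≃⟨ ℚ.toℚᵘ-homo-* (+ a / b) (+ c / d) ⟩
    toℚᵘ (+ a / b) ℚᵘ.* toℚᵘ (+ c / d)     ≃⟨ ℚᵘ.*-cong (toℚᵘ-/ a b) (toℚᵘ-/ c d) ⟩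
    mkℚᵘ (+ a ℤ.* + c) (ℕ.pred (b ℕ.* d))  ≡⟨ cong (λ z → mkℚᵘ z (ℕ.pred (b ℕ.* d))) (sym (ℤ.pos-* a c)) ⟩
    mkℚᵘ (+ (a ℕ.* c)) (ℕ.pred (b ℕ.* d))  ≃⟨ toℚᵘ-/ (a ℕ.* c) (b ℕ.* d) ⟨
    toℚᵘ (+ (a ℕ.* c) / (b ℕ.* d))          ∎)
    where open ℚᵘ.≤-Reasoning

  /-+ : ∀ a b c d .{{_ : NonZero b}} .{{_ : NonZero d}} →
        (+ a / b) + (+ c / d) ≡ (+ (a ℕ.* d ℕ.+ c ℕ.* b) / (b ℕ.* d)) {{ℕ.m*n≢0 b d}}
  /-+ a b@(suc _) c d@(suc _) = ℚ.toℚᵘ-injective (begin-equality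
    toℚᵘ ((+ a / b) + (+ c / d))                       ≃⟨ ℚ.toℚᵘ-homo-+ (+ a / b) (+ c / d) ⟩
    toℚᵘ (+ a / b) ℚᵘ.+ toℚᵘ (+ c / d)                ≃⟨ ℚᵘ.+-cong (toℚᵘ-/ a b) (toℚᵘ-/ c d) ⟩
    mkℚᵘ (+ a ℤ.* + d ℤ.+ + c ℤ.* + b) (ℕ.pred (b ℕ.* d)) ≡⟨ cong (λ z → mkℚᵘ z (ℕ.pred (b ℕ.* d))) numerator ⟩
    mkℚᵘ (+ (a ℕ.* d ℕ.+ c ℕ.* b)) (ℕ.pred (b ℕ.* d))  ≃⟨ toℚᵘ-/ (a ℕ.* d ℕ.+ c ℕ.* b) (b ℕ.* d) ⟨
    toℚᵘ (+ (a ℕ.* d ℕ.+ c ℕ.* b) / (b ℕ.* d))          ∎)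
    where
    open ℚᵘ.≤-Reasoning
    numerator : + a ℤ.* + d ℤ.+ + c ℤ.* + b ≡ + (a ℕ.* d ℕ.+ c ℕ.* b)
    numerator = trans (cong₂ ℤ._+_ (sym (ℤ.pos-* a d)) (sym (ℤ.pos-* c b)))
                      (sym (ℤ.pos-+ (a ℕ.* d) (c ℕ.* b)))

  fromℕ-+ : ∀ a b → fromℕ (a ℕ.+ b) ≡ fromℕ a + fromℕ b
  fromℕ-+ a b = sym (trans (/-+ a 1 b 1) (/-cong (a ℕ.* 1 ℕ.+ b ℕ.* 1) 1 (a ℕ.+ b) 1 (units a b)))
    where
    units : ∀ a b → (a ℕ.* 1 ℕ.+ b ℕ.* 1) ℕ.* 1 ≡ (a ℕ.+ b) ℕ.* (1 ℕ.* 1)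
    units = solve-∀

  fromℕ-* : ∀ a b → fromℕ (a ℕ.* b) ≡ fromℕ a * fromℕ b
  fromℕ-* a b = sym (/-* a 1 b 1)

  fromℕ-mono-≤ : ∀ {a b} → a ℕ.≤ b → fromℕ a ≤ fromℕ b
  fromℕ-mono-≤ {a} {b} a≤b = /-mono-≤ a 1 b 1 (ℕ.*-monoˡ-≤ 1 a≤b)

  fromℕ-nonNeg : ∀ a → 0ℚ ≤ fromℕ a
  fromℕ-nonNeg a = fromℕ-mono-≤ {0} {a} ℕ.z≤n

  /-as-* : ∀ a b .{{_ : NonZero b}} → + a / b ≡ fromℕ a * 1/ℕ b
  /-as-* a b@(suc _) = sym (trans (/-* a 1 1 b) (/-cong (a ℕ.* 1) (1 ℕ.* b) a b (ℕ.*-assoc a 1 b)))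

  1/ℕ-inverseˡ : ∀ b .{{_ : NonZero b}} → 1/ℕ b * fromℕ b ≡ 1ℚ
  1/ℕ-inverseˡ b@(suc _) = trans (/-* 1 b b 1) (/-cong (1 ℕ.* b) (b ℕ.* 1) 1 1 (ℕ.*-assoc 1 b 1))

  1/ℕ-nonNeg : ∀ b .{{_ : NonZero b}} → 0ℚ ≤ 1/ℕ b
  1/ℕ-nonNeg b@(suc _) = /-mono-≤ 0 1 1 b ℕ.z≤n

  sub-mono-≤ : ∀ {p q r s} → p ≤ q → r ≤ s → p - s ≤ q - r
  sub-mono-≤ p≤q r≤s = ℚ.+-mono-≤ p≤q (ℚ.neg-antimono-≤ r≤s)

  p≤q⇒0≤q-p : ∀ {p q} → p ≤ q → 0ℚ ≤ q - p
  p≤q⇒0≤q-p {p} {q} p≤q = subst (_≤ q - p) (ℚ.+-inverseʳ p) (sub-mono-≤ p≤q (ℚ.≤-refl {p}))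

  0<p-q⇒q<p : ∀ {p q} → 0ℚ < p - q → q < p
  0<p-q⇒q<p {p} {q} 0<p-q = subst₂ _<_ (ℚ.+-identityˡ q) (+-*-Solver.solve 2 (λ p q → (p :- q) :+ q := p) refl p q)
                                     (ℚ.+-monoˡ-< q 0<p-q)

  *-monoʳ-≤-0≤ : ∀ {p q} r → 0ℚ ≤ r → p ≤ q → p * r ≤ q * r
  *-monoʳ-≤-0≤ r 0≤r = ℚ.*-monoʳ-≤-nonNeg r {{nonNegative 0≤r}}

  *-monoˡ-≤-0≤ : ∀ {p q} r → 0ℚ ≤ r → p ≤ q → r * p ≤ r * q
  *-monoˡ-≤-0≤ r 0≤r = ℚ.*-monoˡ-≤-nonNeg r {{nonNegative 0≤r}}

  0≤*0≤ : ∀ {p q} → 0ℚ ≤ p → 0ℚ ≤ q → 0ℚ ≤ p * q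
  0≤*0≤ {p} {q} 0≤p 0≤q = subst (_≤ p * q) (ℚ.*-zeroˡ q) (*-monoʳ-≤-0≤ q 0≤q 0≤p)

  fromℕ-*-1/ℕ : ∀ a b .{{_ : NonZero b}} → fromℕ (b ℕ.* a) * 1/ℕ b ≡ fromℕ a
  fromℕ-*-1/ℕ a b@(suc _) = trans (/-* (b ℕ.* a) 1 1 b) (/-cong (b ℕ.* a ℕ.* 1) (1 ℕ.* b) a 1 (reorder a b))
    where
    reorder : ∀ a b → b ℕ.* a ℕ.* 1 ℕ.* 1 ≡ a ℕ.* (1 ℕ.* b)
    reorder = solve-∀

  *-self-mono-≤ : ∀ {p q} → 0ℚ ≤ p → p ≤ q → p * p ≤ q * q
  *-self-mono-≤ {p} {q} 0≤p p≤q =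
    ℚ.≤-trans (*-monoˡ-≤-0≤ p 0≤p p≤q) (*-monoʳ-≤-0≤ q (ℚ.≤-trans 0≤p p≤q) p≤q)

-- Finite sums
module _ where
  open import Data.Nat as ℕ using (ℕ; zero; suc)
  import Data.Nat.Properties as ℕ
  open import Data.Nat.ListAction using (sum)
  open import Data.Rational using (ℚ; _+_; _*_; _-_; 0ℚ; 1ℚ; _≤_)
  import Data.Rational.Properties as ℚ
  open import Data.List using ([]; _∷_; map; upTo; applyUpTo)
  open import Data.List.Relation.Unary.All using (All; []; _∷_)
  open import Data.Sum using (_⊎_; inj₁; inj₂)
  open import Function using (_∘_)
  open import Relation.Binary.PropositionalEquality
  open +-*-Solver using (_:+_; _:-_; _:=_)

  ∑< : ℕ → (ℕ → ℚ) → ℚ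
  ∑< zero    f = 0ℚ
  ∑< (suc n) f = ∑< n f + f n

  syntax ∑< n (λ k → e) = ∑[ k < n ] e

  ∑-suc : ∀ n (f : ℕ → ℚ) → ∑[ k < suc n ] f k ≡ f 0 + ∑[ k < n ] f (suc k)
  ∑-suc zero    f = trans (ℚ.+-identityˡ (f 0)) (sym (ℚ.+-identityʳ (f 0)))
  ∑-suc (suc n) f = trans (cong (_+ f (suc n)) (∑-suc n f)) (ℚ.+-assoc (f 0) (∑[ k < n ] f (suc k)) (f (suc n)))

  sumℚ-map-applyUpTo : ∀ (f : ℕ → ℚ) g n → sumℚ (map f (applyUpTo g n)) ≡ ∑[ k < n ] f (g k)
  sumℚ-map-applyUpTo f g zero    = refl
  sumℚ-map-applyUpTo f g (suc n) = begin
    f (g 0) + sumℚ (map f (applyUpTo (g ∘ suc) n)) ≡⟨ cong (f (g 0) +_) (sumℚ-map-applyUpTo f (g ∘ suc) n) ⟩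
    f (g 0) + ∑[ k < n ] f (g (suc k))              ≡⟨ ∑-suc n (f ∘ g) ⟨
    ∑[ k < suc n ] f (g k)                          ∎
    where open ≡-Reasoning

  sumℚ-map-upTo : ∀ (f : ℕ → ℚ) n → sumℚ (map f (upTo n)) ≡ ∑[ k < n ] f k
  sumℚ-map-upTo f = sumℚ-map-applyUpTo f (λ k → k)

  ∑-cong : ∀ {f g : ℕ → ℚ} n → (∀ k → f k ≡ g k) → ∑[ k < n ] f k ≡ ∑[ k < n ] g k
  ∑-cong zero    f≗g = refl
  ∑-cong (suc n) f≗g = cong₂ _+_ (∑-cong n f≗g) (f≗g n)

  ∑-mono-≤ : ∀ {f g : ℕ → ℚ} n → (∀ k → k ℕ.< n → f k ≤ g k) → ∑[ k < n ] f k ≤ ∑[ k < n ] g k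
  ∑-mono-≤ zero    f≤g = ℚ.≤-refl
  ∑-mono-≤ (suc n) f≤g = ℚ.+-mono-≤ (∑-mono-≤ n (λ k k<n → f≤g k (ℕ.m<n⇒m<1+n k<n))) (f≤g n ℕ.≤-refl)

  ∑-*ʳ : ∀ n (f : ℕ → ℚ) c → ∑[ k < n ] (f k * c) ≡ (∑[ k < n ] f k) * c
  ∑-*ʳ zero    f c = sym (ℚ.*-zeroˡ c)
  ∑-*ʳ (suc n) f c = trans (cong (_+ f n * c) (∑-*ʳ n f c)) (sym (ℚ.*-distribʳ-+ c (∑< n f) (f n)))

  ∑-+ : ∀ n (f g : ℕ → ℚ) → ∑[ k < n ] (f k + g k) ≡ ∑[ k < n ] f k + ∑[ k < n ] g k
  ∑-+ zero    f g = sym (ℚ.+-identityˡ 0ℚ)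
  ∑-+ (suc n) f g = trans (cong (_+ (f n + g n)) (∑-+ n f g))
    (+-*-Solver.solve 4 (λ a b c d → (a :+ b) :+ (c :+ d) := (a :+ c) :+ (b :+ d)) refl (∑< n f) (∑< n g) (f n) (g n))

  ∑-0 : ∀ n → ∑[ k < n ] 0ℚ ≡ 0ℚ
  ∑-0 zero    = refl
  ∑-0 (suc n) = trans (ℚ.+-identityʳ _) (∑-0 n)

  ∑-telescope : ∀ n (f : ℕ → ℚ) → ∑[ k < n ] (f (suc k) - f k) ≡ f n - f 0
  ∑-telescope zero    f = sym (ℚ.+-inverseʳ (f 0))
  ∑-telescope (suc n) f = trans (cong (_+ (f (suc n) - f n)) (∑-telescope n f))
    (+-*-Solver.solve 3 (λ a b c → (b :- a) :+ (c :- b) := c :- a) refl (f 0) (f n) (f (suc n)))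

  ∑-weighted≤ : ∀ N (p x : ℕ → ℚ) {B} → (∀ j → 0ℚ ≤ p j) → 0ℚ ≤ B → ∑[ j < N ] p j ≤ 1ℚ →
                (∀ j → p j ≡ 0ℚ ⊎ x j ≤ B) → ∑[ j < N ] (p j * x j) ≤ B
  ∑-weighted≤ N p x {B} 0≤p 0≤B ∑p≤1 x≤B = begin
    ∑[ j < N ] (p j * x j) ≤⟨ ∑-mono-≤ N (λ j _ → term j) ⟩
    ∑[ j < N ] (p j * B)   ≡⟨ ∑-*ʳ N p B ⟩
    (∑[ j < N ] p j) * B   ≤⟨ *-monoʳ-≤-0≤ B 0≤B ∑p≤1 ⟩
    1ℚ * B                 ≡⟨ ℚ.*-identityˡ B ⟩
    B                      ∎
    where
    open ℚ.≤-Reasoning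
    term : ∀ j → p j * x j ≤ p j * B
    term j with x≤B j
    ... | inj₁ p≡0 rewrite p≡0 = ℚ.≤-reflexive (trans (ℚ.*-zeroˡ (x j)) (sym (ℚ.*-zeroˡ B)))
    ... | inj₂ x≤B = *-monoˡ-≤-0≤ (p j) (0≤p j) x≤B

  sumℚ-mono-All : ∀ {A : Set} {P : A → Set} {f g : A → ℚ} {xs} → All P xs →
                  (∀ {x} → P x → f x ≤ g x) → sumℚ (map f xs) ≤ sumℚ (map g xs)
  sumℚ-mono-All []         f≤g = ℚ.≤-refl
  sumℚ-mono-All (px ∷ pxs) f≤g = ℚ.+-mono-≤ (f≤g px) (sumℚ-mono-All pxs f≤g)

  sumℚ-nonNeg : ∀ {A : Set} (f : A → ℚ) xs → (∀ x → 0ℚ ≤ f x) → 0ℚ ≤ sumℚ (map f xs)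
  sumℚ-nonNeg f []       0≤f = ℚ.≤-refl
  sumℚ-nonNeg f (x ∷ xs) 0≤f = ℚ.+-mono-≤ (0≤f x) (sumℚ-nonNeg f xs 0≤f)

  sumℚ-∑-comm : ∀ {A : Set} n (f : A → ℕ → ℚ) xs →
                sumℚ (map (λ x → ∑[ k < n ] f x k) xs) ≡ ∑[ k < n ] sumℚ (map (λ x → f x k) xs)
  sumℚ-∑-comm n f []       = sym (∑-0 n)
  sumℚ-∑-comm n f (x ∷ xs) = trans (cong (∑< n (f x) +_) (sumℚ-∑-comm n f xs))
                                   (sym (∑-+ n (f x) (λ k → sumℚ (map (λ y → f y k) xs))))

  sumℚ-map-fromℕ-* : ∀ {A : Set} (f : A → ℕ) c xs →
                     sumℚ (map (λ x → fromℕ (f x) * c) xs) ≡ fromℕ (sum (map f xs)) * c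
  sumℚ-map-fromℕ-* f c []       = sym (ℚ.*-zeroˡ c)
  sumℚ-map-fromℕ-* f c (x ∷ xs) = begin
    fromℕ (f x) * c + sumℚ (map (λ x → fromℕ (f x) * c) xs) ≡⟨ cong (fromℕ (f x) * c +_) (sumℚ-map-fromℕ-* f c xs) ⟩
    fromℕ (f x) * c + fromℕ (sum (map f xs)) * c           ≡⟨ ℚ.*-distribʳ-+ c (fromℕ (f x)) _ ⟨
    (fromℕ (f x) + fromℕ (sum (map f xs))) * c             ≡⟨ cong (_* c) (fromℕ-+ (f x) _) ⟨
    fromℕ (sum (map f (x ∷ xs))) * c                        ∎
    where open ≡-Reasoning

-- Sums over all arrival orders
module _ where
  import Algebra.Properties.CommutativeSemigroup as CommSemigroupProperties
  open import Data.Nat using (ℕ; zero; suc; _+_; _*_; _∸_; _≤_; _<_; _!; _<?_; ∣_-_∣; z≤n; s≤s)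
  open import Data.Nat.Properties
  open import Data.Nat.ListAction using (sum)
  open import Data.Nat.ListAction.Properties using (sum-++)
  open import Data.Nat.Tactic.RingSolver using (solve-∀)
  open import Data.List using (List; []; _∷_; _++_; map; concatMap; filter; length)
  open import Data.List.Properties using (filter-++; filter-reject; filter-all; length-++; length-map; map-∘; map-++; map-cong)
  open import Data.List.Relation.Unary.All as All using (All; []; _∷_)
  import Data.List.Relation.Unary.All.Properties as All
  open import Data.Product using (_×_; _,_; uncurry)
  open import Data.Sum using (inj₁; inj₂)
  open import Relation.Binary.PropositionalEquality
  open import Relation.Nullary using (¬_)

  sum-map-const : ∀ {A : Set} (xs : List A) c → sum (map (λ _ → c) xs) ≡ length xs * c
  sum-map-const []       c = refl
  sum-map-const (x ∷ xs) c = cong (c +_) (sum-map-const xs c)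

  sum-map-∘ : ∀ {A B : Set} (f : B → ℕ) (g : A → B) xs → sum (map f (map g xs)) ≡ sum (map (λ x → f (g x)) xs)
  sum-map-∘ f g xs = cong sum (sym (map-∘ xs))

  sum-map-cong-All : ∀ {A : Set} {P : A → Set} {f g : A → ℕ} {xs} → All P xs →
                     (∀ {x} → P x → f x ≡ g x) → sum (map f xs) ≡ sum (map g xs)
  sum-map-cong-All []         f≡g = refl
  sum-map-cong-All (px ∷ pxs) f≡g = cong₂ _+_ (f≡g px) (sum-map-cong-All pxs f≡g)

  sum-map-+ : ∀ {A : Set} (f g : A → ℕ) xs → sum (map (λ x → f x + g x) xs) ≡ sum (map f xs) + sum (map g xs)
  sum-map-+ f g []       = refl
  sum-map-+ f g (x ∷ xs) = trans (cong (f x + g x +_) (sum-map-+ f g xs))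
                                 (+-interchange (f x) (g x) (sum (map f xs)) (sum (map g xs)))
    where open CommSemigroupProperties +-commutativeSemigroup renaming (interchange to +-interchange)

  sum-map-*ˡ : ∀ {A : Set} c (f : A → ℕ) xs → sum (map (λ x → c * f x) xs) ≡ c * sum (map f xs)
  sum-map-*ˡ c f []       = sym (*-zeroʳ c)
  sum-map-*ˡ c f (x ∷ xs) = trans (cong (c * f x +_) (sum-map-*ˡ c f xs)) (sym (*-distribˡ-+ c (f x) _))

  sum-map-linear : ∀ {A : Set} α β (f g : A → ℕ) xs →
                   sum (map (λ x → α * f x + β * g x) xs) ≡ α * sum (map f xs) + β * sum (map g xs)
  sum-map-linear α β f g xs =
    trans (sum-map-+ (λ x → α * f x) (λ x → β * g x) xs) (cong₂ _+_ (sum-map-*ˡ α f xs) (sum-map-*ˡ β g xs))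

  sum-map-concatMap : ∀ {A B : Set} (g : B → ℕ) (f : A → List B) xs →
                      sum (map g (concatMap f xs)) ≡ sum (map (λ x → sum (map g (f x))) xs)
  sum-map-concatMap g f []       = refl
  sum-map-concatMap g f (x ∷ xs) = begin
    sum (map g (f x ++ concatMap f xs))              ≡⟨ cong sum (map-++ g (f x) (concatMap f xs)) ⟩
    sum (map g (f x) ++ map g (concatMap f xs))      ≡⟨ sum-++ (map g (f x)) _ ⟩
    sum (map g (f x)) + sum (map g (concatMap f xs)) ≡⟨ cong (sum (map g (f x)) +_) (sum-map-concatMap g f xs) ⟩
    sum (map (λ x → sum (map g (f x))) (x ∷ xs))     ∎
    where open ≡-Reasoning

  length-concatMap : ∀ {A B : Set} (f : A → List B) xs →
                     length (concatMap f xs) ≡ sum (map (λ x → length (f x)) xs)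
  length-concatMap f []       = refl
  length-concatMap f (x ∷ xs) = trans (length-++ (f x)) (cong (length (f x) +_) (length-concatMap f xs))

  localRank-++-≮ : ∀ {x a} e₁ e₂ → ¬ (x < a) → localRank (e₁ ++ x ∷ e₂) a ≡ localRank (e₁ ++ e₂) a
  localRank-++-≮ {x} {a} e₁ e₂ x≮a = begin
    length (filter (_<? a) (e₁ ++ x ∷ e₂))                 ≡⟨ cong length (filter-++ (_<? a) e₁ (x ∷ e₂)) ⟩
    length (filter (_<? a) e₁ ++ filter (_<? a) (x ∷ e₂)) ≡⟨ cong (λ l → length (filter (_<? a) e₁ ++ l)) (filter-reject (_<? a) x≮a) ⟩
    length (filter (_<? a) e₁ ++ filter (_<? a) e₂)       ≡⟨ cong length (filter-++ (_<? a) e₁ e₂) ⟨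
    length (filter (_<? a) (e₁ ++ e₂))                     ∎
    where open ≡-Reasoning

  localRank-all< : ∀ {x e} → All (_< x) e → localRank e x ≡ length e
  localRank-all< {x} e<x = cong length (filter-all (_<? x) e<x)

  -- (local rank, value) of the entry at position k of σ when the entries e arrived earlier; (0 , 0) past the end
  observe : List ℕ → ℕ → List ℕ → ℕ × ℕ
  observe e k       []      = 0 , 0
  observe e zero    (a ∷ σ) = localRank e a , a
  observe e (suc k) (a ∷ σ) = observe (a ∷ e) k σ

  observe-++-larger : ∀ {x} e₁ e₂ k σ → All (_< x) σ → observe (e₁ ++ x ∷ e₂) k σ ≡ observe (e₁ ++ e₂) k σ
  observe-++-larger e₁ e₂ k       []      _           = refl
  observe-++-larger e₁ e₂ zero    (a ∷ σ) (a<x ∷ _)   = cong (_, a) (localRank-++-≮ e₁ e₂ (<-asym a<x))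
  observe-++-larger e₁ e₂ (suc k) (a ∷ σ) (_ ∷ σ<x)   = observe-++-larger (a ∷ e₁) e₂ k σ σ<x

  length-insertions : ∀ x σ → length (insertions x σ) ≡ suc (length σ)
  length-insertions x []       = refl
  length-insertions x (y ∷ ys) = cong suc (trans (length-map (y ∷_) (insertions x ys)) (length-insertions x ys))

  statAt : (ℕ → ℕ → ℕ) → List ℕ → ℕ → List ℕ → ℕ
  statAt h e k σ = uncurry h (observe e k σ)

  -- Inserting a new maximum x into σ: at positions after k (|σ| ∸ k ways) the k-th entry is unchanged,
  -- at positions before k (k ways) it is the former (k ∸ 1)-th entry, and at position k it is x itself.
  sum-insertions-statAt : ∀ h x e σ k → All (_< x) e → All (_< x) σ → k ≤ length σ →
    sum (map (statAt h e k) (insertions x σ)) ≡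
    (length σ ∸ k) * statAt h e k σ + k * statAt h e (k ∸ 1) σ + h (length e + k) x
  sum-insertions-statAt h x e [] zero e<x _ _ = begin
    h (localRank e x) x + 0 ≡⟨ +-identityʳ _ ⟩
    h (localRank e x) x     ≡⟨ cong (λ r → h r x) (trans (localRank-all< e<x) (sym (+-identityʳ _))) ⟩
    h (length e + 0) x      ∎
    where open ≡-Reasoning
  sum-insertions-statAt h x e (y ∷ ys) zero e<x _ _ = begin
    h (localRank e x) x + sum (map (statAt h e 0) (map (y ∷_) (insertions x ys)))
      ≡⟨ cong₂ _+_ (cong (λ r → h r x) (trans (localRank-all< e<x) (sym (+-identityʳ _))))
                   (sum-map-∘ (statAt h e 0) (y ∷_) (insertions x ys)) ⟩
    h (length e + 0) x + sum (map (λ _ → Y) (insertions x ys))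
      ≡⟨ cong (h (length e + 0) x +_) (trans (sum-map-const (insertions x ys) Y) (cong (_* Y) (length-insertions x ys))) ⟩
    h (length e + 0) x + suc (length ys) * Y
      ≡⟨ trans (+-comm (h (length e + 0) x) _) (cong (_+ h (length e + 0) x) (sym (+-identityʳ _))) ⟩
    suc (length ys) * Y + 0 + h (length e + 0) x ∎
    where
    open ≡-Reasoning
    Y = h (localRank e y) y
  sum-insertions-statAt h x e (y ∷ ys) (suc k) e<x (y<x ∷ ys<x) (s≤s k≤) = begin
    statAt h (x ∷ e) k (y ∷ ys) + sum (map (statAt h e (suc k)) (map (y ∷_) (insertions x ys)))
      ≡⟨ cong₂ _+_ (cong (uncurry h) (observe-++-larger [] e k (y ∷ ys) (y<x ∷ ys<x)))
                   (sum-map-∘ (statAt h e (suc k)) (y ∷_) (insertions x ys)) ⟩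
    A + sum (map (statAt h (y ∷ e) k) (insertions x ys))
      ≡⟨ cong (A +_) (sum-insertions-statAt h x (y ∷ e) ys k (y<x ∷ e<x) ys<x k≤) ⟩
    A + ((length ys ∸ k) * B + k * statAt h (y ∷ e) (k ∸ 1) ys + h (suc (length e) + k) x)
      ≡⟨ cong₂ (λ u v → A + ((length ys ∸ k) * B + u + h v x)) (shift k) (sym (+-suc (length e) k)) ⟩
    A + ((length ys ∸ k) * B + k * A + h (length e + suc k) x)
      ≡⟨ regroup A ((length ys ∸ k) * B) (k * A) (h (length e + suc k) x) ⟩
    (length ys ∸ k) * B + suc k * A + h (length e + suc k) x ∎
    where
    open ≡-Reasoning
    A = statAt h e k (y ∷ ys)
    B = statAt h (y ∷ e) k ys
    shift : ∀ k → k * statAt h (y ∷ e) (k ∸ 1) ys ≡ k * statAt h e k (y ∷ ys)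
    shift zero    = refl
    shift (suc k) = refl
    regroup : ∀ a b c d → a + (b + c + d) ≡ b + (a + c) + d
    regroup = solve-∀

  insertions-shape : ∀ {b} x σ → x < b → All (_< b) σ →
                     All (λ τ → length τ ≡ suc (length σ) × All (_< b) τ) (insertions x σ)
  insertions-shape x []       x<b []          = (refl , x<b ∷ []) ∷ []
  insertions-shape x (y ∷ ys) x<b (y<b ∷ ys<b) =
    (refl , x<b ∷ y<b ∷ ys<b) ∷
    All.map⁺ (All.map (λ (l , τ<b) → cong suc l , y<b ∷ τ<b) (insertions-shape x ys x<b ys<b))

  perms-shape : ∀ m → All (λ σ → length σ ≡ m × All (_< suc m) σ) (perms m)
  perms-shape zero    = (refl , []) ∷ []
  perms-shape (suc m) = All.concat⁺ (All.map⁺ (All.map shape (perms-shape m)))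
    where
    shape : ∀ {σ} → length σ ≡ m × All (_< suc m) σ →
            All (λ τ → length τ ≡ suc m × All (_< suc (suc m)) τ) (insertions (suc m) σ)
    shape {σ} (l , σ<) = All.map (λ (l′ , τ<) → trans l′ (cong suc l) , τ<)
                                 (insertions-shape (suc m) σ ≤-refl (All.map m<n⇒m<1+n σ<))

  length-perms : ∀ m → length (perms m) ≡ m !
  length-perms zero    = refl
  length-perms (suc m) = begin
    length (concatMap (insertions (suc m)) (perms m))          ≡⟨ length-concatMap (insertions (suc m)) (perms m) ⟩
    sum (map (λ σ → length (insertions (suc m) σ)) (perms m))
      ≡⟨ sum-map-cong-All (perms-shape m) (λ {σ} (l , _) → trans (length-insertions (suc m) σ) (cong suc l)) ⟩
    sum (map (λ _ → suc m) (perms m))                          ≡⟨ sum-map-const (perms m) (suc m) ⟩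
    length (perms m) * suc m                                   ≡⟨ cong (_* suc m) (length-perms m) ⟩
    m ! * suc m                                                ≡⟨ *-comm (m !) (suc m) ⟩
    suc m ! ∎
    where open ≡-Reasoning

  permSum : (ℕ → ℕ → ℕ) → ℕ → ℕ → ℕ
  permSum h m k = sum (map (statAt h [] k) (perms m))

  permSum-suc : ∀ h m k → k ≤ m →
    permSum h (suc m) k ≡ (m ∸ k) * permSum h m k + k * permSum h m (k ∸ 1) + m ! * h k (suc m)
  permSum-suc h m k k≤m = begin
    sum (map (statAt h [] k) (concatMap (insertions (suc m)) (perms m)))
      ≡⟨ sum-map-concatMap (statAt h [] k) (insertions (suc m)) (perms m) ⟩
    sum (map (λ σ → sum (map (statAt h [] k) (insertions (suc m) σ))) (perms m))
      ≡⟨ sum-map-cong-All (perms-shape m) insert ⟩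
    sum (map (λ σ → (m ∸ k) * statAt h [] k σ + k * statAt h [] (k ∸ 1) σ + h k (suc m)) (perms m))
      ≡⟨ sum-map-+ (λ σ → (m ∸ k) * statAt h [] k σ + k * statAt h [] (k ∸ 1) σ) (λ _ → h k (suc m)) (perms m) ⟩
    sum (map (λ σ → (m ∸ k) * statAt h [] k σ + k * statAt h [] (k ∸ 1) σ) (perms m)) + sum (map (λ _ → h k (suc m)) (perms m))
      ≡⟨ cong₂ _+_ (sum-map-linear (m ∸ k) k (statAt h [] k) (statAt h [] (k ∸ 1)) (perms m))
                   (trans (sum-map-const (perms m) (h k (suc m))) (cong (_* h k (suc m)) (length-perms m))) ⟩
    (m ∸ k) * permSum h m k + k * permSum h m (k ∸ 1) + m ! * h k (suc m) ∎
    where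
    open ≡-Reasoning
    insert : ∀ {σ} → length σ ≡ m × All (_< suc m) σ →
             sum (map (statAt h [] k) (insertions (suc m) σ)) ≡ (m ∸ k) * statAt h [] k σ + k * statAt h [] (k ∸ 1) σ + h k (suc m)
    insert {σ} (refl , σ<) = sum-insertions-statAt h (suc m) [] σ k [] σ< k≤m

  permSum-closedForm : ∀ h c (C : ℕ → ℕ → ℕ) →
    (∀ m k → k ≤ m → (m ∸ k) * C m k + k * C m (k ∸ 1) + c * (m ! * h k (suc m)) ≡ C (suc m) k) →
    ∀ m k → k < m → c * permSum h m k ≡ C m k
  permSum-closedForm h c C rec (suc m) k (s≤s k≤m) = begin
    c * permSum h (suc m) k
      ≡⟨ cong (c *_) (permSum-suc h m k k≤m) ⟩
    c * ((m ∸ k) * permSum h m k + k * permSum h m (k ∸ 1) + m ! * h k (suc m))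
      ≡⟨ distrib (m ∸ k) k (permSum h m k) (permSum h m (k ∸ 1)) (m ! * h k (suc m)) ⟩
    (m ∸ k) * (c * permSum h m k) + k * (c * permSum h m (k ∸ 1)) + c * (m ! * h k (suc m))
      ≡⟨ cong₂ (λ u v → u + v + c * (m ! * h k (suc m))) unchanged (shifted k≤m) ⟩
    (m ∸ k) * C m k + k * C m (k ∸ 1) + c * (m ! * h k (suc m))
      ≡⟨ rec m k k≤m ⟩
    C (suc m) k ∎
    where
    open ≡-Reasoning
    open CommSemigroupProperties *-commutativeSemigroup using (x∙yz≈y∙xz)
    distrib : ∀ a b x y z → c * (a * x + b * y + z) ≡ a * (c * x) + b * (c * y) + c * z
    distrib a b x y z = begin
      c * (a * x + b * y + z)             ≡⟨ *-distribˡ-+ c (a * x + b * y) z ⟩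
      c * (a * x + b * y) + c * z         ≡⟨ cong (_+ c * z) (*-distribˡ-+ c (a * x) (b * y)) ⟩
      c * (a * x) + c * (b * y) + c * z   ≡⟨ cong₂ (λ u v → u + v + c * z) (x∙yz≈y∙xz c a x) (x∙yz≈y∙xz c b y) ⟩
      a * (c * x) + b * (c * y) + c * z   ∎
    unchanged : (m ∸ k) * (c * permSum h m k) ≡ (m ∸ k) * C m k
    unchanged with m≤n⇒m<n∨m≡n k≤m
    ... | inj₁ k<m  = cong ((m ∸ k) *_) (permSum-closedForm h c C rec m k k<m)
    ... | inj₂ refl rewrite n∸n≡0 k = refl
    shifted : ∀ {j} → j ≤ m → j * (c * permSum h m (j ∸ 1)) ≡ j * C m (j ∸ 1)
    shifted {zero}  _   = refl
    shifted {suc j} j<m = cong (suc j *_) (permSum-closedForm h c C rec m j j<m)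

  permSum-a² : ∀ m k → k < m → 6 * permSum (λ r a → a * a) m k ≡ m ! * (suc m * (2 * m + 1))
  permSum-a² = permSum-closedForm (λ r a → a * a) 6 (λ m k → m ! * (suc m * (2 * m + 1))) rec
    where
    poly : ∀ F k j → j * (F * (suc (k + j) * (2 * (k + j) + 1))) + k * (F * (suc (k + j) * (2 * (k + j) + 1)))
                     + 6 * (F * (suc (k + j) * suc (k + j)))
                   ≡ (suc (k + j) * F) * (suc (suc (k + j)) * (2 * suc (k + j) + 1))
    poly = solve-∀
    rec : ∀ m k → k ≤ m → (m ∸ k) * (m ! * (suc m * (2 * m + 1))) + k * (m ! * (suc m * (2 * m + 1)))
                          + 6 * (m ! * (suc m * suc m)) ≡ suc m ! * (suc (suc m) * (2 * suc m + 1))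
    rec m k k≤m with m≤n⇒∃[o]m+o≡n k≤m
    ... | j , refl rewrite m+n∸m≡n k j = poly ((k + j) !) k j

  permSum-r² : ∀ m k → k < m → 6 * permSum (λ r a → r * r) m k ≡ m ! * (k * (2 * k + 1))
  permSum-r² = permSum-closedForm (λ r a → r * r) 6 (λ m k → m ! * (k * (2 * k + 1))) rec
    where
    poly₀ : ∀ F m → m * (F * 0) + 0 + 6 * (F * 0) ≡ (suc m * F) * 0
    poly₀ = solve-∀
    poly : ∀ F k j → j * (F * (suc k * (2 * suc k + 1))) + suc k * (F * (k * (2 * k + 1))) + 6 * (F * (suc k * suc k))
                   ≡ (suc (suc k + j) * F) * (suc k * (2 * suc k + 1))
    poly = solve-∀
    rec : ∀ m k → k ≤ m → (m ∸ k) * (m ! * (k * (2 * k + 1))) + k * (m ! * ((k ∸ 1) * (2 * (k ∸ 1) + 1)))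
                          + 6 * (m ! * (k * k)) ≡ suc m ! * (k * (2 * k + 1))
    rec m zero    _   = poly₀ (m !) m
    rec m (suc k) k≤m with m≤n⇒∃[o]m+o≡n k≤m
    ... | j , refl rewrite m+n∸m≡n (suc k) j = poly ((suc k + j) !) k j

  permSum-ra : ∀ m k → k < m → 3 * permSum (λ r a → r * a) m k ≡ m ! * (suc m * k)
  permSum-ra = permSum-closedForm (λ r a → r * a) 3 (λ m k → m ! * (suc m * k)) rec
    where
    poly₀ : ∀ F m → m * (F * (suc m * 0)) + 0 + 3 * (F * 0) ≡ (suc m * F) * (suc (suc m) * 0)
    poly₀ = solve-∀
    poly : ∀ F k j → j * (F * (suc (suc k + j) * suc k)) + suc k * (F * (suc (suc k + j) * k))
                     + 3 * (F * (suc k * suc (suc k + j)))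
                   ≡ (suc (suc k + j) * F) * (suc (suc (suc k + j)) * suc k)
    poly = solve-∀
    rec : ∀ m k → k ≤ m → (m ∸ k) * (m ! * (suc m * k)) + k * (m ! * (suc m * (k ∸ 1)))
                          + 3 * (m ! * (k * suc m)) ≡ suc m ! * (suc (suc m) * k)
    rec m zero    _   = poly₀ (m !) m
    rec m (suc k) k≤m with m≤n⇒∃[o]m+o≡n k≤m
    ... | j , refl rewrite m+n∸m≡n (suc k) j = poly ((suc k + j) !) k j

  permSum-cong : ∀ {f g : ℕ → ℕ → ℕ} m k → (∀ r a → f r a ≡ g r a) → permSum f m k ≡ permSum g m k
  permSum-cong {f} {g} m k f≗g = cong sum (map-cong (λ σ → f≗g _ _) (perms m))

  permSum-linear : ∀ α β (f g : ℕ → ℕ → ℕ) m k →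
                   permSum (λ r a → α * f r a + β * g r a) m k ≡ α * permSum f m k + β * permSum g m k
  permSum-linear α β f g m k = sum-map-linear α β (statAt f [] k) (statAt g [] k) (perms m)

  permSum-const : ∀ c m k → permSum (λ _ _ → c) m k ≡ m ! * c
  permSum-const c m k = trans (sum-map-const (perms m) c) (cong (_* c) (length-perms m))

  ∣m-n∣²+2mn≡m²+n² : ∀ m n → ∣ m - n ∣ * ∣ m - n ∣ + 2 * (m * n) ≡ m * m + n * n
  ∣m-n∣²+2mn≡m²+n² m n with ≤-total m n
  ... | inj₁ m≤n with m≤n⇒∃[o]m+o≡n m≤n
  ...   | d , refl rewrite ∣m-m+n∣≡n m d = square m d
    where square : ∀ m d → d * d + 2 * (m * (m + d)) ≡ m * m + (m + d) * (m + d)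
          square = solve-∀
  ∣m-n∣²+2mn≡m²+n² m n | inj₂ n≤m with m≤n⇒∃[o]m+o≡n n≤m
  ...   | d , refl rewrite ∣-∣-comm (n + d) n | ∣m-m+n∣≡n n d = square n d
    where square : ∀ n d → d * d + 2 * ((n + d) * n) ≡ (n + d) * (n + d) + n * n
          square = solve-∀

  2mn≤m²+n² : ∀ m n → 2 * (m * n) ≤ m * m + n * n
  2mn≤m²+n² m n = ≤-trans (m≤n+m _ (∣ m - n ∣ * ∣ m - n ∣)) (≤-reflexive (∣m-n∣²+2mn≡m²+n² m n))

  dev : ℕ → ℕ → ℕ → ℕ → ℕ
  dev n t r a = ∣ t * a - r * n ∣

  permSum-dev²-identity : ∀ n k → k < n →
    6 * permSum (λ r a → dev n (suc k) r a * dev n (suc k) r a) n k + 4 * suc k * n * (n ! * (suc n * k))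
    ≡ (suc k * suc k) * (n ! * (suc n * (2 * n + 1))) + (n * n) * (n ! * (k * (2 * k + 1)))
  permSum-dev²-identity n k k<n = begin
    6 * S dev² + 4 * t * n * (n ! * (suc n * k))
      ≡⟨ cong (λ z → 6 * S dev² + 4 * t * n * z) (permSum-ra n k k<n) ⟨
    6 * S dev² + 4 * t * n * (3 * S (λ r a → r * a))
      ≡⟨ regroup₁ (S dev²) (S (λ r a → r * a)) t n ⟩
    6 * (1 * S dev² + (2 * t * n) * S (λ r a → r * a))
      ≡⟨ cong (6 *_) (permSum-linear 1 (2 * t * n) dev² (λ r a → r * a) n k) ⟨
    6 * S (λ r a → 1 * dev² r a + (2 * t * n) * (r * a))
      ≡⟨ cong (6 *_) (permSum-cong n k expand) ⟩
    6 * S (λ r a → (t * t) * (a * a) + (n * n) * (r * r))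
      ≡⟨ cong (6 *_) (permSum-linear (t * t) (n * n) (λ r a → a * a) (λ r a → r * r) n k) ⟩
    6 * ((t * t) * S (λ r a → a * a) + (n * n) * S (λ r a → r * r))
      ≡⟨ regroup₂ (S (λ r a → a * a)) (S (λ r a → r * r)) t n ⟩
    (t * t) * (6 * S (λ r a → a * a)) + (n * n) * (6 * S (λ r a → r * r))
      ≡⟨ cong₂ (λ u v → (t * t) * u + (n * n) * v) (permSum-a² n k k<n) (permSum-r² n k k<n) ⟩
    (t * t) * (n ! * (suc n * (2 * n + 1))) + (n * n) * (n ! * (k * (2 * k + 1))) ∎
    where
    open ≡-Reasoning
    t = suc k
    S : (ℕ → ℕ → ℕ) → ℕ
    S h = permSum h n k
    dev² : ℕ → ℕ → ℕ
    dev² r a = dev n t r a * dev n t r a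
    regroup₁ : ∀ d q t n → 6 * d + 4 * t * n * (3 * q) ≡ 6 * (1 * d + (2 * t * n) * q)
    regroup₁ = solve-∀
    regroup₂ : ∀ a b t n → 6 * ((t * t) * a + (n * n) * b) ≡ (t * t) * (6 * a) + (n * n) * (6 * b)
    regroup₂ = solve-∀
    reorder : ∀ t a r n → 2 * ((t * a) * (r * n)) ≡ (2 * t * n) * (r * a)
    reorder = solve-∀
    squares : ∀ t a r n → (t * a) * (t * a) + (r * n) * (r * n) ≡ (t * t) * (a * a) + (n * n) * (r * r)
    squares = solve-∀
    expand : ∀ r a → 1 * dev² r a + (2 * t * n) * (r * a) ≡ (t * t) * (a * a) + (n * n) * (r * r)
    expand r a = begin
      1 * dev² r a + (2 * t * n) * (r * a)   ≡⟨ cong₂ _+_ (*-identityˡ (dev² r a)) (sym (reorder t a r n)) ⟩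
      dev² r a + 2 * ((t * a) * (r * n))     ≡⟨ ∣m-n∣²+2mn≡m²+n² (t * a) (r * n) ⟩
      (t * a) * (t * a) + (r * n) * (r * n)  ≡⟨ squares t a r n ⟩
      (t * t) * (a * a) + (n * n) * (r * r)  ∎

  permSum-dev²≤ : ∀ n k → k < n →
    6 * permSum (λ r a → dev n (suc k) r a * dev n (suc k) r a) n k ≤ 7 * (n * n) * suc k * n !
  permSum-dev²≤ n k k<n with m≤n⇒∃[o]m+o≡n k<n
  ... | j , refl = m+n≤o⇒m≤o (6 * X) (≤-reflexive (+-cancelʳ-≡ Z (6 * X + F * slack) (7 * (n * n) * t * F) balance))
    where
    t = suc k
    F = n !
    X = permSum (λ r a → dev n t r a * dev n t r a) n k
    Z = 4 * t * n * (F * (suc n * k))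
    -- (7n²t·n! + Z − right side of permSum-dev²-identity)/n!, a polynomial in k and j = n − k − 1 with nonnegative coefficients
    slack : ℕ
    slack = 1 + 7 * j + 5 * (j * j) + 9 * k + 20 * (k * j) + 6 * (k * (j * j)) + 15 * (k * k)
            + 13 * (k * k * j) + 7 * (k * k * k)
    poly : ∀ F k j →
      (suc k * suc k) * (F * (suc (suc k + j) * (2 * (suc k + j) + 1))) + ((suc k + j) * (suc k + j)) * (F * (k * (2 * k + 1)))
      + F * (1 + 7 * j + 5 * (j * j) + 9 * k + 20 * (k * j) + 6 * (k * (j * j)) + 15 * (k * k) + 13 * (k * k * j) + 7 * (k * k * k))
      ≡ 7 * ((suc k + j) * (suc k + j)) * suc k * F + 4 * suc k * (suc k + j) * (F * (suc (suc k + j) * k))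
    poly = solve-∀
    swap : ∀ x y z → x + y + z ≡ x + z + y
    swap = solve-∀
    balance : 6 * X + F * slack + Z ≡ 7 * (n * n) * t * F + Z
    balance = begin
      6 * X + F * slack + Z       ≡⟨ swap (6 * X) (F * slack) Z ⟩
      6 * X + Z + F * slack       ≡⟨ cong (_+ F * slack) (permSum-dev²-identity n k k<n) ⟩
      _                           ≡⟨ poly F k j ⟩
      7 * (n * n) * t * F + Z     ∎
      where open ≡-Reasoning

  errorWeight : ℕ → ℕ → ℕ → ℕ → ℕ → ℕ
  errorWeight n t s r a = dev n t r a * dev n t r a + (n * n * (s * s) + 2 * n * s * (n + t))

  permSum-errorWeight≤ : ∀ n k s → k < n → s * s ≤ suc k →
                         permSum (errorWeight n (suc k) s) n k ≤ 8 * (n * n) * suc k * n !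
  permSum-errorWeight≤ n k s k<n s²≤t = *-cancelˡ-≤ 6 (begin
    6 * permSum (errorWeight n t s) n k
      ≡⟨ cong (6 *_) (trans (permSum-cong n k (λ r a → sym (cong₂ _+_ (*-identityˡ (dev² r a)) (*-identityˡ c))))
                            (permSum-linear 1 1 dev² (λ _ _ → c) n k)) ⟩
    6 * (1 * permSum dev² n k + 1 * permSum (λ _ _ → c) n k)
      ≡⟨ cong (λ z → 6 * (1 * permSum dev² n k + 1 * z)) (permSum-const c n k) ⟩
    6 * (1 * permSum dev² n k + 1 * (F * c))
      ≡⟨ regroup (permSum dev² n k) F c ⟩
    6 * permSum dev² n k + F * (6 * c)
      ≤⟨ +-mono-≤ (permSum-dev²≤ n k k<n) (*-monoʳ-≤ F 6c≤) ⟩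
    7 * (n * n) * t * F + F * (30 * (n * n * t))
      ≤⟨ ≤-reflexive (collect n t F) ⟩
    37 * (n * n * t * F)
      ≤⟨ *-monoˡ-≤ (n * n * t * F) (m≤m+n 37 11) ⟩
    48 * (n * n * t * F)
      ≡⟨ split n t F ⟩
    6 * (8 * (n * n) * t * F) ∎)
    where
    open ≤-Reasoning
    t = suc k
    F = n !
    c = n * n * (s * s) + 2 * n * s * (n + t)
    dev² : ℕ → ℕ → ℕ
    dev² r a = dev n t r a * dev n t r a
    regroup : ∀ d F c → 6 * (1 * d + 1 * (F * c)) ≡ 6 * d + F * (6 * c)
    regroup = solve-∀
    collect : ∀ n t F → 7 * (n * n) * t * F + F * (30 * (n * n * t)) ≡ 37 * (n * n * t * F)
    collect = solve-∀
    split : ∀ n t F → 48 * (n * n * t * F) ≡ 6 * (8 * (n * n) * t * F)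
    split = solve-∀
    five : ∀ n t → n * n * t + 2 * n * t * (n + n) ≡ 5 * (n * n * t)
    five = solve-∀
    s≤t : s ≤ t
    s≤t = ≤-trans (m≤m*m s) s²≤t
      where m≤m*m : ∀ m → m ≤ m * m
            m≤m*m zero    = z≤n
            m≤m*m (suc m) = m≤m*n (suc m) (suc m)
    6c≤ : 6 * c ≤ 30 * (n * n * t)
    6c≤ = begin
      6 * c                                      ≤⟨ *-monoʳ-≤ 6 (+-mono-≤ (*-monoʳ-≤ (n * n) s²≤t)
                                                       (*-mono-≤ (*-monoʳ-≤ (2 * n) s≤t) (+-monoʳ-≤ n k<n))) ⟩
      6 * (n * n * t + 2 * n * t * (n + n))      ≡⟨ cong (6 *_) (five n t) ⟩
      6 * (5 * (n * n * t))                      ≡⟨ *-assoc 6 5 (n * n * t) ⟨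
      30 * (n * n * t)                           ∎

-- The expected error of one arrival
module _ where
  open import Data.Nat as ℕ using (ℕ; suc; _∸_; ∣_-_∣; NonZero)
  import Data.Nat.Properties as ℕ
  open import Data.Nat.Tactic.RingSolver using (solve-∀)
  open import Data.Integer using (+_)
  open import Data.Rational using (ℚ; _/_; _+_; _*_; _-_; 0ℚ; 1ℚ; _≤_; _<_; _⊔_; _⊓_; _<?_)
  import Data.Rational.Properties as ℚ
  open import Data.Product using (_×_; _,_)
  open import Data.Sum using (_⊎_; inj₁; inj₂)
  open import Relation.Binary.PropositionalEquality
  open import Relation.Nullary using (yes; no)
  open +-*-Solver using (_:+_; _:*_; _:-_; _:=_)

  -- The hypotheses say that j + 1 is a possible value of ⌈x⌉ for x ∈ [rn/t, (r+1)n/t].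
  ∣a-j∣-bound : ∀ n t r a j → r ℕ.* n ℕ.< suc j ℕ.* t → j ℕ.* t ℕ.< suc r ℕ.* n →
                t ℕ.* ∣ a - suc j ∣ ℕ.≤ dev n t r a ℕ.+ n ℕ.+ t
  ∣a-j∣-bound n t r a j rn<[j+1]t jt<[r+1]n with ℕ.m≤n⇒∃[o]m+o≡n (ℕ.<⇒≤ rn<[j+1]t)
  ... | d , rn+d≡[j+1]t = begin
    t ℕ.* ∣ a - suc j ∣                         ≡⟨ ℕ.*-distribˡ-∣-∣ t a (suc j) ⟩
    ∣ t ℕ.* a - t ℕ.* suc j ∣                   ≤⟨ ℕ.∣-∣-triangle (t ℕ.* a) (r ℕ.* n) (t ℕ.* suc j) ⟩
    dev n t r a ℕ.+ ∣ r ℕ.* n - t ℕ.* suc j ∣   ≡⟨ cong (λ z → dev n t r a ℕ.+ ∣ r ℕ.* n - z ∣) (trans (ℕ.*-comm t (suc j)) (sym rn+d≡[j+1]t)) ⟩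
    dev n t r a ℕ.+ ∣ r ℕ.* n - r ℕ.* n ℕ.+ d ∣ ≡⟨ cong (dev n t r a ℕ.+_) (ℕ.∣m-m+n∣≡n (r ℕ.* n) d) ⟩
    dev n t r a ℕ.+ d                           ≤⟨ ℕ.+-monoʳ-≤ (dev n t r a) d≤n+t ⟩
    dev n t r a ℕ.+ (n ℕ.+ t)                   ≡⟨ ℕ.+-assoc (dev n t r a) n t ⟨
    dev n t r a ℕ.+ n ℕ.+ t                     ∎
    where
    open ℕ.≤-Reasoning
    regroup : ∀ r n t → suc r ℕ.* n ℕ.+ t ≡ r ℕ.* n ℕ.+ (n ℕ.+ t)
    regroup = solve-∀
    rn+d<rn+n+t : r ℕ.* n ℕ.+ d ℕ.< r ℕ.* n ℕ.+ (n ℕ.+ t)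
    rn+d<rn+n+t = begin-strict
      r ℕ.* n ℕ.+ d             ≡⟨ rn+d≡[j+1]t ⟩
      suc j ℕ.* t               ≡⟨ ℕ.+-comm t (j ℕ.* t) ⟩
      j ℕ.* t ℕ.+ t             <⟨ ℕ.+-monoˡ-< t jt<[r+1]n ⟩
      suc r ℕ.* n ℕ.+ t         ≡⟨ regroup r n t ⟩
      r ℕ.* n ℕ.+ (n ℕ.+ t)     ∎
    d≤n+t : d ℕ.≤ n ℕ.+ t
    d≤n+t = ℕ.<⇒≤ (ℕ.+-cancelˡ-< (r ℕ.* n) d (n ℕ.+ t) rn+d<rn+n+t)

  module _ (n t : ℕ) .{{_ : NonZero n}} .{{_ : NonZero t}} (r : ℕ) where

    private
      lo : ℚ
      lo = + (r ℕ.* n) / t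

      hi : ℚ
      hi = + (suc r ℕ.* n) / t

      -- ceilProb n t r k unfolds to (0ℚ ⊔ cellOverlap k) * (+ t / n).
      cellOverlap : ℕ → ℚ
      cellOverlap k = (hi ⊓ fromℕ k) - (lo ⊔ fromℕ (k ∸ 1))

      clip : ℕ → ℚ
      clip k = lo ⊔ (hi ⊓ fromℕ k)

      clip-suc : ∀ j → clip j ≤ clip (suc j)
      clip-suc j = ℚ.⊔-monoʳ-≤ lo (ℚ.⊓-monoʳ-≤ hi (fromℕ-mono-≤ (ℕ.n≤1+n j)))

      cellOverlap≤Δclip : ∀ j → 0ℚ ⊔ cellOverlap (suc j) ≤ clip (suc j) - clip j
      cellOverlap≤Δclip j = ℚ.⊔-lub (p≤q⇒0≤q-p (clip-suc j))
        (sub-mono-≤ (ℚ.p≤q⊔p lo (hi ⊓ fromℕ (suc j))) (ℚ.⊔-monoʳ-≤ lo (ℚ.p⊓q≤q hi (fromℕ j))))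

      lo≤hi : lo ≤ hi
      lo≤hi = /-mono-≤ (r ℕ.* n) t (suc r ℕ.* n) t (ℕ.*-monoˡ-≤ t (ℕ.m≤n+m (r ℕ.* n) n))

      ∑-cellOverlap≤ : ∀ N → ∑[ j < N ] (0ℚ ⊔ cellOverlap (suc j)) ≤ hi - lo
      ∑-cellOverlap≤ N = begin
        ∑[ j < N ] (0ℚ ⊔ cellOverlap (suc j))   ≤⟨ ∑-mono-≤ N (λ j _ → cellOverlap≤Δclip j) ⟩
        ∑[ j < N ] (clip (suc j) - clip j)  ≡⟨ ∑-telescope N clip ⟩
        clip N - clip 0                     ≤⟨ sub-mono-≤ (ℚ.⊔-lub lo≤hi (ℚ.p⊓q≤p hi (fromℕ N))) (ℚ.p≤p⊔q lo (hi ⊓ fromℕ 0)) ⟩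
        hi - lo                             ∎
        where open ℚ.≤-Reasoning

      hi-lo : hi - lo ≡ fromℕ n * 1/ℕ t
      hi-lo = begin
        hi - lo                                                  ≡⟨ cong₂ _-_ (/-as-* (suc r ℕ.* n) t) (/-as-* (r ℕ.* n) t) ⟩
        fromℕ (n ℕ.+ r ℕ.* n) * 1/ℕ t - fromℕ (r ℕ.* n) * 1/ℕ t ≡⟨ cong (λ z → z * 1/ℕ t - fromℕ (r ℕ.* n) * 1/ℕ t) (fromℕ-+ n (r ℕ.* n)) ⟩
        (fromℕ n + fromℕ (r ℕ.* n)) * 1/ℕ t - fromℕ (r ℕ.* n) * 1/ℕ t
          ≡⟨ +-*-Solver.solve 3 (λ a b v → (a :+ b) :* v :- b :* v := a :* v) refl (fromℕ n) (fromℕ (r ℕ.* n)) (1/ℕ t) ⟩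
        fromℕ n * 1/ℕ t                                          ∎
        where open ≡-Reasoning

      ratio-nonNeg : 0ℚ ≤ + t / n
      ratio-nonNeg = /-mono-≤ 0 1 t n ℕ.z≤n

    ceilProb-nonNeg : ∀ k → 0ℚ ≤ ceilProb n t r k
    ceilProb-nonNeg k = 0≤*0≤ (ℚ.p≤p⊔q 0ℚ (cellOverlap k)) ratio-nonNeg

    ∑-ceilProb≤1 : ∀ N → ∑[ j < N ] ceilProb n t r (suc j) ≤ 1ℚ
    ∑-ceilProb≤1 N = begin
      ∑[ j < N ] ceilProb n t r (suc j)                 ≡⟨ ∑-*ʳ N (λ j → 0ℚ ⊔ cellOverlap (suc j)) (+ t / n) ⟩
      (∑[ j < N ] (0ℚ ⊔ cellOverlap (suc j))) * (+ t / n)   ≤⟨ *-monoʳ-≤-0≤ (+ t / n) ratio-nonNeg (∑-cellOverlap≤ N) ⟩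
      (hi - lo) * (+ t / n)                             ≡⟨ cong₂ _*_ hi-lo (/-as-* t n) ⟩
      fromℕ n * 1/ℕ t * (fromℕ t * 1/ℕ n)
        ≡⟨ +-*-Solver.solve 4 (λ a b c d → a :* b :* (c :* d) := (b :* c) :* (d :* a)) refl (fromℕ n) (1/ℕ t) (fromℕ t) (1/ℕ n) ⟩
      (1/ℕ t * fromℕ t) * (1/ℕ n * fromℕ n)            ≡⟨ cong₂ _*_ (1/ℕ-inverseˡ t) (1/ℕ-inverseˡ n) ⟩
      1ℚ * 1ℚ                                           ≡⟨ ℚ.*-identityˡ 1ℚ ⟩
      1ℚ                                                ∎
      where open ℚ.≤-Reasoning

    ceilProb-support : ∀ j → ceilProb n t r (suc j) ≡ 0ℚ ⊎ (r ℕ.* n ℕ.< suc j ℕ.* t × j ℕ.* t ℕ.< suc r ℕ.* n)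
    ceilProb-support j with 0ℚ <? cellOverlap (suc j)
    ... | no  0≮cellOverlap = inj₁ (trans (cong (_* (+ t / n)) (ℚ.p≥q⇒p⊔q≡p (ℚ.≮⇒≥ 0≮cellOverlap))) (ℚ.*-zeroˡ (+ t / n)))
    ... | yes 0<cellOverlap = inj₂ (rn<[j+1]t , jt<[r+1]n)
      where
      lo⊔j<hi⊓[j+1] : lo ⊔ fromℕ j < hi ⊓ fromℕ (suc j)
      lo⊔j<hi⊓[j+1] = 0<p-q⇒q<p 0<cellOverlap
      rn<[j+1]t : r ℕ.* n ℕ.< suc j ℕ.* t
      rn<[j+1]t = subst (ℕ._< suc j ℕ.* t) (ℕ.*-identityʳ (r ℕ.* n)) (/-cancel-< (r ℕ.* n) t (suc j) 1
        (ℚ.≤-<-trans (ℚ.p≤p⊔q lo (fromℕ j)) (ℚ.<-≤-trans lo⊔j<hi⊓[j+1] (ℚ.p⊓q≤q hi (fromℕ (suc j))))))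
      jt<[r+1]n : j ℕ.* t ℕ.< suc r ℕ.* n
      jt<[r+1]n = subst (j ℕ.* t ℕ.<_) (ℕ.*-identityʳ (suc r ℕ.* n)) (/-cancel-< j 1 (suc r ℕ.* n) t
        (ℚ.≤-<-trans (ℚ.p≤q⊔p lo (fromℕ j)) (ℚ.<-≤-trans lo⊔j<hi⊓[j+1] (ℚ.p⊓q≤p hi (fromℕ (suc j))))))

    expectedError≤ : ∀ a → expectedError n t r a ≤ fromℕ (dev n t r a ℕ.+ n ℕ.+ t) * 1/ℕ t
    expectedError≤ a = begin
      expectedError n t r a                                         ≡⟨ sumℚ-map-upTo _ n ⟩
      ∑[ j < n ] (ceilProb n t r (suc j) * fromℕ ∣ a - suc j ∣)      ≤⟨ ∑-weighted≤ n (λ j → ceilProb n t r (suc j)) _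
                                                                        (λ j → ceilProb-nonNeg (suc j)) (0≤*0≤ (fromℕ-nonNeg (dev n t r a ℕ.+ n ℕ.+ t)) (1/ℕ-nonNeg t))
                                                                        (∑-ceilProb≤1 n) close ⟩
      fromℕ (dev n t r a ℕ.+ n ℕ.+ t) * 1/ℕ t                       ∎
      where
      open ℚ.≤-Reasoning
      close : ∀ j → ceilProb n t r (suc j) ≡ 0ℚ ⊎ fromℕ ∣ a - suc j ∣ ≤ fromℕ (dev n t r a ℕ.+ n ℕ.+ t) * 1/ℕ t
      close j with ceilProb-support j
      ... | inj₁ p≡0                       = inj₁ p≡0
      ... | inj₂ (rn<[j+1]t , jt<[r+1]n) = inj₂ (subst (_≤ fromℕ (dev n t r a ℕ.+ n ℕ.+ t) * 1/ℕ t) (fromℕ-*-1/ℕ ∣ a - suc j ∣ t)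
              (*-monoʳ-≤-0≤ (1/ℕ t) (1/ℕ-nonNeg t) (fromℕ-mono-≤ (∣a-j∣-bound n t r a j rn<[j+1]t jt<[r+1]n))))

    expectedError-nonNeg : ∀ a → 0ℚ ≤ expectedError n t r a
    expectedError-nonNeg a = begin
      0ℚ                                                       ≡⟨ ∑-0 n ⟨
      ∑[ j < n ] 0ℚ                                            ≤⟨ ∑-mono-≤ n (λ j _ → 0≤*0≤ (ceilProb-nonNeg (suc j)) (fromℕ-nonNeg ∣ a - suc j ∣)) ⟩
      ∑[ j < n ] (ceilProb n t r (suc j) * fromℕ ∣ a - suc j ∣) ≡⟨ sumℚ-map-upTo _ n ⟨
      expectedError n t r a                                    ∎
      where open ℚ.≤-Reasoning

-- Integer square roots
module _ where
  open import Data.Nat using (ℕ; zero; suc; _+_; _*_; _≤_; _<_; _≤?_; z≤n; s≤s)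
  open import Data.Nat.Properties
  open import Data.Nat.Tactic.RingSolver using (solve-∀)
  open import Data.Integer using (+_)
  open import Data.Rational using (ℚ; _/_) renaming (_+_ to _+ℚ_; _≤_ to _≤ℚ_)
  import Data.Rational.Properties as ℚ
  open import Data.Product using (_×_; _,_; proj₂)
  open import Data.Sum using (_⊎_; inj₁; inj₂)
  open import Data.Unit using (tt)
  open import Relation.Binary.PropositionalEquality
  open import Relation.Nullary using (yes; no)
  open import Relation.Nullary.Decidable using (toWitness)

  -- suc (rootPred k) = ⌊√(k+1)⌋
  rootPred : ℕ → ℕ
  rootPred zero    = 0
  rootPred (suc k) with suc (suc (rootPred k)) * suc (suc (rootPred k)) ≤? suc (suc k)
  ... | yes _ = suc (rootPred k)
  ... | no  _ = rootPred k

  rootPred-spec : ∀ k → suc (rootPred k) * suc (rootPred k) ≤ suc k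
                        × suc k < suc (suc (rootPred k)) * suc (suc (rootPred k))
  rootPred-spec zero = s≤s z≤n , s≤s (s≤s z≤n)
  rootPred-spec (suc k) with suc (suc (rootPred k)) * suc (suc (rootPred k)) ≤? suc (suc k) | rootPred-spec k
  ... | yes s′²≤k+2 | (_ , k+1<s′²) = s′²≤k+2 , ≤-<-trans k+1<s′² (*-mono-< (n<1+n s′) (n<1+n s′))
    where s′ = suc (suc (rootPred k))
  ... | no  s′²≰k+2 | (s²≤k+1 , _) = m≤n⇒m≤1+n s²≤k+1 , ≰⇒> s′²≰k+2

  rootPred-suc : ∀ k → rootPred (suc k) ≡ rootPred k
                       ⊎ (rootPred (suc k) ≡ suc (rootPred k) × suc (suc k) ≡ suc (suc (rootPred k)) * suc (suc (rootPred k)))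
  rootPred-suc k with suc (suc (rootPred k)) * suc (suc (rootPred k)) ≤? suc (suc k)
  ... | yes s′²≤k+2 = inj₂ (refl , ≤-antisym (proj₂ (rootPred-spec k)) s′²≤k+2)
  ... | no  _       = inj₁ refl

  private
    -- (k + 1)/s + 2s for s = ⌊√(k+1)⌋: it grows by exactly 1/s inside a block of equal roots and by 1 where the root increases
    potential : ℕ → ℚ
    potential k = + (suc k + 2 * (suc (rootPred k) * suc (rootPred k))) / suc (rootPred k)

    potential-step : ∀ K v′ → v′ ≡ rootPred K ⊎ (v′ ≡ suc (rootPred K) × suc (suc K) ≡ suc (suc (rootPred K)) * suc (suc (rootPred K))) →
      potential K +ℚ 1/ℕ (suc v′) ≤ℚ + (suc (suc K) + 2 * (suc v′ * suc v′)) / suc v′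
    potential-step K .(rootPred K) (inj₁ refl) = begin
      potential K +ℚ 1/ℕ s
        ≡⟨ /-+ (suc K + 2 * (s * s)) s 1 s ⟩
      + ((suc K + 2 * (s * s)) * s + 1 * s) / (s * s)
        ≤⟨ /-mono-≤ ((suc K + 2 * (s * s)) * s + 1 * s) (s * s) (suc (suc K) + 2 * (s * s)) s (≤-reflexive (same-block (rootPred K) K)) ⟩
      + (suc (suc K) + 2 * (s * s)) / s ∎
      where
      open ℚ.≤-Reasoning
      s = suc (rootPred K)
      same-block : ∀ v K → ((suc K + 2 * (suc v * suc v)) * suc v + 1 * suc v) * suc v
                           ≡ (suc (suc K) + 2 * (suc v * suc v)) * (suc v * suc v)
      same-block = solve-∀
    potential-step K .(suc (rootPred K)) (inj₂ (refl , K+2≡s′²)) = begin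
      potential K +ℚ 1/ℕ (suc s)
        ≡⟨ /-+ (suc K + 2 * (s * s)) s 1 (suc s) ⟩
      + ((suc K + 2 * (s * s)) * suc s + 1 * s) / (s * suc s)
        ≤⟨ /-mono-≤ ((suc K + 2 * (s * s)) * suc s + 1 * s) (s * suc s) (suc (suc K) + 2 * (suc s * suc s)) (suc s) (new-block (rootPred K) K K+2≡s′²) ⟩
      + (suc (suc K) + 2 * (suc s * suc s)) / suc s ∎
      where
      open ℚ.≤-Reasoning
      s = suc (rootPred K)
      identity : ∀ v → let K = v + suc v * suc (suc v) in
        ((suc K + 2 * (suc v * suc v)) * suc (suc v) + 1 * suc v) * suc (suc v) + suc v * suc v * suc (suc v)
        ≡ (suc (suc K) + 2 * (suc (suc v) * suc (suc v))) * (suc v * suc (suc v))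
      identity = solve-∀
      new-block : ∀ v K → suc (suc K) ≡ suc (suc v) * suc (suc v) →
        ((suc K + 2 * (suc v * suc v)) * suc (suc v) + 1 * suc v) * suc (suc v)
        ≤ (suc (suc K) + 2 * (suc (suc v) * suc (suc v))) * (suc v * suc (suc v))
      new-block v K K+2≡[v+2]² with suc-injective (suc-injective K+2≡[v+2]²)
      ... | refl = ≤-trans (m≤m+n _ _) (≤-reflexive (identity v))

    ∑-1/root≤potential : ∀ K → ∑[ k < suc K ] 1/ℕ (suc (rootPred k)) ≤ℚ potential K
    ∑-1/root≤potential zero    = toWitness {a? = ∑[ k < 1 ] 1/ℕ (suc (rootPred k)) ℚ.≤? potential 0} tt
    ∑-1/root≤potential (suc K) = ℚ.≤-trans (ℚ.+-monoˡ-≤ (1/ℕ (suc (rootPred (suc K)))) (∑-1/root≤potential K))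
                                            (potential-step K (rootPred (suc K)) (rootPred-suc K))

    potential≤ : ∀ K → potential K ≤ℚ fromℕ (5 * suc (rootPred K))
    potential≤ K = /-mono-≤ (suc K + 2 * (s * s)) s (5 * s) 1 (begin
      (suc K + 2 * (s * s)) * 1        ≡⟨ *-identityʳ (suc K + 2 * (s * s)) ⟩
      suc K + 2 * (s * s)              ≤⟨ +-monoˡ-≤ (2 * (s * s)) (≤-pred (proj₂ (rootPred-spec K))) ⟩
      s + s * suc s + 2 * (s * s)      ≤⟨ m≤m+n _ (2 * rootPred K * s) ⟩
      s + s * suc s + 2 * (s * s) + 2 * rootPred K * s ≡⟨ five (rootPred K) ⟩
      5 * s * s                        ∎)
      where
      open ≤-Reasoning
      s = suc (rootPred K)
      five : ∀ v → suc v + suc v * suc (suc v) + 2 * (suc v * suc v) + 2 * v * suc v ≡ 5 * suc v * suc v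
      five = solve-∀

  ∑-1/root≤ : ∀ K → ∑[ k < suc K ] 1/ℕ (suc (rootPred k)) ≤ℚ fromℕ (5 * suc (rootPred K))
  ∑-1/root≤ K = ℚ.≤-trans (∑-1/root≤potential K) (potential≤ K)

-- The expected total error
module _ where
  open import Data.Nat as ℕ using (ℕ; suc; _!; _^_; NonZero)
  import Data.Nat.Properties as ℕ
  open import Data.Nat.Tactic.RingSolver using (solve-∀)
  open import Data.Integer using (+_)
  open import Data.Rational using (ℚ; _/_; _+_; _*_; 0ℚ; 1ℚ; _≤_)
  import Data.Rational.Properties as ℚ
  open import Data.List using ([]; _∷_; map; length)
  open import Data.Product using (_,_; proj₁; uncurry)
  open import Relation.Binary.PropositionalEquality

  module _ (n : ℕ) .{{_ : NonZero n}} (bound : ℕ → ℕ → ℕ → ℚ)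
           (expectedError≤bound : ∀ k r a → expectedError n (suc k) r a ≤ bound k r a) where

    orderError≤∑ : ∀ e i σ → orderError n e i σ ≤ ∑[ k < length σ ] uncurry (bound (i ℕ.+ k)) (observe e k σ)
    orderError≤∑ e i []      = ℚ.≤-refl
    orderError≤∑ e i (a ∷ σ) = begin
      expectedError n (suc i) (localRank e a) a + orderError n (a ∷ e) (suc i) σ
        ≤⟨ ℚ.+-mono-≤ (expectedError≤bound i (localRank e a) a) (orderError≤∑ (a ∷ e) (suc i) σ) ⟩
      bound i (localRank e a) a + ∑[ k < length σ ] uncurry (bound (suc i ℕ.+ k)) (observe (a ∷ e) k σ)
        ≡⟨ cong₂ _+_ (cong (λ j → bound j (localRank e a) a) (ℕ.+-identityʳ i))
                     (∑-cong (length σ) (λ k → cong (λ j → uncurry (bound j) (observe (a ∷ e) k σ)) (ℕ.+-suc i k))) ⟨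
      bound (i ℕ.+ 0) (localRank e a) a + ∑[ k < length σ ] uncurry (bound (i ℕ.+ suc k)) (observe (a ∷ e) k σ)
        ≡⟨ ∑-suc (length σ) (λ k → uncurry (bound (i ℕ.+ k)) (observe e k (a ∷ σ))) ⟨
      ∑[ k < suc (length σ) ] uncurry (bound (i ℕ.+ k)) (observe e k (a ∷ σ)) ∎
      where open ℚ.≤-Reasoning

  -- AM-GM with the free scale n·s: D ≤ (D² + (ns)²)/(2ns).
  expectedError≤errorWeight : ∀ m v k r a →
    expectedError (suc m) (suc k) r a ≤ fromℕ (errorWeight (suc m) (suc k) (suc v) r a) * 1/ℕ (2 ℕ.* suc m ℕ.* suc v ℕ.* suc k)
  expectedError≤errorWeight m v k r a = begin
    expectedError n t r a               ≤⟨ expectedError≤ n t r a ⟩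
    fromℕ (D ℕ.+ n ℕ.+ t) * 1/ℕ t      ≡⟨ /-as-* (D ℕ.+ n ℕ.+ t) t ⟨
    + (D ℕ.+ n ℕ.+ t) / t              ≤⟨ /-mono-≤ (D ℕ.+ n ℕ.+ t) t W (2 ℕ.* n ℕ.* s ℕ.* t) amgm ⟩
    + W / (2 ℕ.* n ℕ.* s ℕ.* t)        ≡⟨ /-as-* W (2 ℕ.* n ℕ.* s ℕ.* t) ⟩
    fromℕ W * 1/ℕ (2 ℕ.* n ℕ.* s ℕ.* t) ∎
    where
    open ℚ.≤-Reasoning
    n = suc m
    s = suc v
    t = suc k
    D = dev n t r a
    W = errorWeight n t s r a
    expand : ∀ D n s t → (D ℕ.+ n ℕ.+ t) ℕ.* (2 ℕ.* n ℕ.* s ℕ.* t) ≡ (2 ℕ.* (D ℕ.* (n ℕ.* s)) ℕ.+ 2 ℕ.* n ℕ.* s ℕ.* (n ℕ.+ t)) ℕ.* t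
    expand = solve-∀
    collect : ∀ D n s t → (D ℕ.* D ℕ.+ (n ℕ.* s) ℕ.* (n ℕ.* s) ℕ.+ 2 ℕ.* n ℕ.* s ℕ.* (n ℕ.+ t)) ℕ.* t
                          ≡ (D ℕ.* D ℕ.+ (n ℕ.* n ℕ.* (s ℕ.* s) ℕ.+ 2 ℕ.* n ℕ.* s ℕ.* (n ℕ.+ t))) ℕ.* t
    collect = solve-∀
    amgm : (D ℕ.+ n ℕ.+ t) ℕ.* (2 ℕ.* n ℕ.* s ℕ.* t) ℕ.≤ W ℕ.* t
    amgm = ℕ.≤-trans (ℕ.≤-reflexive (expand D n s t))
          (ℕ.≤-trans (ℕ.*-monoˡ-≤ t (ℕ.+-monoˡ-≤ (2 ℕ.* n ℕ.* s ℕ.* (n ℕ.+ t)) (2mn≤m²+n² D (n ℕ.* s))))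
                     (ℕ.≤-reflexive (collect D n s t)))

  module _ (m : ℕ) where

    private
      n : ℕ
      n = suc m

      s : ℕ → ℕ
      s k = suc (rootPred k)

      weight : ℕ → ℕ → ℕ → ℕ
      weight k = errorWeight n (suc k) (s k)

      scale : ℕ → ℚ
      scale k = 1/ℕ (2 ℕ.* n ℕ.* s k ℕ.* suc k)

    orderError≤weights : ∀ σ → length σ ≡ n → orderError n [] 0 σ ≤ ∑[ k < n ] (fromℕ (statAt (weight k) [] k σ) * scale k)
    orderError≤weights σ |σ|≡n = subst (λ N → orderError n [] 0 σ ≤ ∑[ k < N ] (fromℕ (statAt (weight k) [] k σ) * scale k)) |σ|≡n
      (orderError≤∑ n (λ k r a → fromℕ (weight k r a) * scale k) (λ k → expectedError≤errorWeight m (rootPred k) k) [] 0 σ)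

    weight-scale : ∀ k → fromℕ (8 ℕ.* (n ℕ.* n) ℕ.* suc k ℕ.* n !) * scale k ≡ 1/ℕ (s k) * fromℕ (4 ℕ.* n) * fromℕ (n !)
    weight-scale k = begin
      fromℕ (8 ℕ.* (n ℕ.* n) ℕ.* suc k ℕ.* n !) * scale k
        ≡⟨ /-* (8 ℕ.* (n ℕ.* n) ℕ.* suc k ℕ.* n !) 1 1 (2 ℕ.* n ℕ.* s k ℕ.* suc k) ⟩
      + (8 ℕ.* (n ℕ.* n) ℕ.* suc k ℕ.* n ! ℕ.* 1) / (1 ℕ.* (2 ℕ.* n ℕ.* s k ℕ.* suc k))
        ≡⟨ /-cong (8 ℕ.* (n ℕ.* n) ℕ.* suc k ℕ.* n ! ℕ.* 1) (1 ℕ.* (2 ℕ.* n ℕ.* s k ℕ.* suc k)) (1 ℕ.* (4 ℕ.* n) ℕ.* n !) (s k ℕ.* 1 ℕ.* 1) (reorder n (s k) (suc k) (n !)) ⟩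
      + (1 ℕ.* (4 ℕ.* n) ℕ.* n !) / (s k ℕ.* 1 ℕ.* 1)
        ≡⟨ trans (cong (_* fromℕ (n !)) (/-* 1 (s k) (4 ℕ.* n) 1)) (/-* (1 ℕ.* (4 ℕ.* n)) (s k ℕ.* 1) (n !) 1) ⟨
      1/ℕ (s k) * fromℕ (4 ℕ.* n) * fromℕ (n !) ∎
      where
      open ≡-Reasoning
      reorder : ∀ n s t F → 8 ℕ.* (n ℕ.* n) ℕ.* t ℕ.* F ℕ.* 1 ℕ.* (s ℕ.* 1 ℕ.* 1) ≡ 1 ℕ.* (4 ℕ.* n) ℕ.* F ℕ.* (1 ℕ.* (2 ℕ.* n ℕ.* s ℕ.* t))
      reorder = solve-∀

    ∑-orderError≤ : sumℚ (map (orderError n [] 0) (perms n)) ≤ (∑[ k < n ] 1/ℕ (s k)) * fromℕ (4 ℕ.* n) * fromℕ (n !)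
    ∑-orderError≤ = begin
      sumℚ (map (orderError n [] 0) (perms n))
        ≤⟨ sumℚ-mono-All (perms-shape n) (λ {σ} (|σ|≡n , _) → orderError≤weights σ |σ|≡n) ⟩
      sumℚ (map (λ σ → ∑[ k < n ] (fromℕ (statAt (weight k) [] k σ) * scale k)) (perms n))
        ≡⟨ sumℚ-∑-comm n (λ σ k → fromℕ (statAt (weight k) [] k σ) * scale k) (perms n) ⟩
      ∑[ k < n ] sumℚ (map (λ σ → fromℕ (statAt (weight k) [] k σ) * scale k) (perms n))
        ≡⟨ ∑-cong n (λ k → sumℚ-map-fromℕ-* (statAt (weight k) [] k) (scale k) (perms n)) ⟩
      ∑[ k < n ] (fromℕ (permSum (weight k) n k) * scale k)
        ≤⟨ ∑-mono-≤ n (λ k k<n → *-monoʳ-≤-0≤ (scale k) (1/ℕ-nonNeg (2 ℕ.* n ℕ.* s k ℕ.* suc k))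
                                   (fromℕ-mono-≤ (permSum-errorWeight≤ n k (s k) k<n (proj₁ (rootPred-spec k))))) ⟩
      ∑[ k < n ] (fromℕ (8 ℕ.* (n ℕ.* n) ℕ.* suc k ℕ.* n !) * scale k)
        ≡⟨ ∑-cong n weight-scale ⟩
      ∑[ k < n ] (1/ℕ (s k) * fromℕ (4 ℕ.* n) * fromℕ (n !))
        ≡⟨ trans (∑-*ʳ n (λ k → 1/ℕ (s k) * fromℕ (4 ℕ.* n)) (fromℕ (n !)))
                 (cong (_* fromℕ (n !)) (∑-*ʳ n (λ k → 1/ℕ (s k)) (fromℕ (4 ℕ.* n)))) ⟩
      (∑[ k < n ] 1/ℕ (s k)) * fromℕ (4 ℕ.* n) * fromℕ (n !) ∎
      where open ℚ.≤-Reasoning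

    expectedTotalError-nonNeg : 0ℚ ≤ expectedTotalError n
    expectedTotalError-nonNeg = 0≤*0≤ (sumℚ-nonNeg (orderError n [] 0) (perms n) (orderError-nonNeg [] 0))
                                     ((1/ℕ-nonNeg (n !)) {{n ℕ.!≢0}})
      where
      orderError-nonNeg : ∀ e i σ → 0ℚ ≤ orderError n e i σ
      orderError-nonNeg e i []      = ℚ.≤-refl
      orderError-nonNeg e i (a ∷ σ) = ℚ.+-mono-≤ (expectedError-nonNeg n (suc i) (localRank e a) a) (orderError-nonNeg (a ∷ e) (suc i) σ)

    expectedTotalError≤ : expectedTotalError n ≤ fromℕ (5 ℕ.* s m ℕ.* (4 ℕ.* n))
    expectedTotalError≤ = begin
      sumℚ (map (orderError n [] 0) (perms n)) * 1/n!
        ≤⟨ *-monoʳ-≤-0≤ 1/n! ((1/ℕ-nonNeg (n !)) {{n ℕ.!≢0}}) ∑-orderError≤ ⟩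
      H * fromℕ (4 ℕ.* n) * fromℕ (n !) * 1/n!
        ≡⟨ ℚ.*-assoc (H * fromℕ (4 ℕ.* n)) (fromℕ (n !)) 1/n! ⟩
      H * fromℕ (4 ℕ.* n) * (fromℕ (n !) * 1/n!)
        ≡⟨ cong (H * fromℕ (4 ℕ.* n) *_) (trans (ℚ.*-comm (fromℕ (n !)) 1/n!) ((1/ℕ-inverseˡ (n !)) {{n ℕ.!≢0}})) ⟩
      H * fromℕ (4 ℕ.* n) * 1ℚ
        ≡⟨ ℚ.*-identityʳ (H * fromℕ (4 ℕ.* n)) ⟩
      H * fromℕ (4 ℕ.* n)
        ≤⟨ *-monoʳ-≤-0≤ (fromℕ (4 ℕ.* n)) (fromℕ-nonNeg (4 ℕ.* n)) (∑-1/root≤ m) ⟩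
      fromℕ (5 ℕ.* s m) * fromℕ (4 ℕ.* n)
        ≡⟨ fromℕ-* (5 ℕ.* s m) (4 ℕ.* n) ⟨
      fromℕ (5 ℕ.* s m ℕ.* (4 ℕ.* n)) ∎
      where
      open ℚ.≤-Reasoning
      H = ∑[ k < n ] 1/ℕ (s k)
      1/n! = (1/ℕ (n !)) {{n ℕ.!≢0}}

    expectedTotalError²≤ : expectedTotalError n * expectedTotalError n ≤ fromℕ (400 ℕ.* n ^ 3)
    expectedTotalError²≤ = begin
      expectedTotalError n * expectedTotalError n
        ≤⟨ *-self-mono-≤ expectedTotalError-nonNeg expectedTotalError≤ ⟩
      fromℕ B * fromℕ B
        ≡⟨ fromℕ-* B B ⟨
      fromℕ (B ℕ.* B)
        ≤⟨ fromℕ-mono-≤ (ℕ.≤-trans (ℕ.≤-reflexive (square (s m) n))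
                        (ℕ.≤-trans (ℕ.*-monoʳ-≤ (400 ℕ.* (n ℕ.* n)) (proj₁ (rootPred-spec m))) (ℕ.≤-reflexive (cube n)))) ⟩
      fromℕ (400 ℕ.* n ^ 3) ∎
      where
      open ℚ.≤-Reasoning
      B = 5 ℕ.* s m ℕ.* (4 ℕ.* n)
      square : ∀ s n → 5 ℕ.* s ℕ.* (4 ℕ.* n) ℕ.* (5 ℕ.* s ℕ.* (4 ℕ.* n)) ≡ 400 ℕ.* (n ℕ.* n) ℕ.* (s ℕ.* s)
      square = solve-∀
      cube : ∀ n → 400 ℕ.* (n ℕ.* n) ℕ.* n ≡ 400 ℕ.* (n ℕ.* (n ℕ.* (n ℕ.* 1)))
      cube = solve-∀

open import Data.Nat as ℕ using (ℕ; suc; _≤_; _^_)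
open import Data.Integer using (+_)
open import Data.Rational as ℚ using (_/_; _*_)
open import Data.Product using (∃₂; _,_)

lemma3p2 : ∃₂ λ (C N : ℕ) → ∀ (m : ℕ) → N ≤ suc m →
    (expectedTotalError (suc m) * expectedTotalError (suc m)) ℚ.≤ (+ (C ℕ.* (suc m ^ 3)) / 1)
lemma3p2 = 400 , 0 , λ m _ → expectedTotalError²≤ m
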